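{- Let $P$ be a finite poset. Then $A(S_N(P))=\emptyset$.
   Context: For a poset $Q$, a covering pair is $(x,y)$ with $x<y$ and no $z$ with $x<z<y$; write $x\prec y$. $Diag(Q)$ is the set of covering pairs of $Q$, and $Inc(Q)$ is the set of pairs of incomparable elements. Four elements $a,b,c,d\in Q$ form an $N$ in $Q$ if $b\prec c$, $a\prec c$, $b\prec d$ and $(a,d)\in Inc(Q)$; the pair $(b,c)$ is called the diagonal edge of this $N$. $N_{diag}(Q)$ denotes the set of diagonal edges of all $N$'s in $Q$. $S_N(Q)$ is the poset obtained from $Q$ by adding exactly one new vertex $u_e$ on each edge $e=(x,y)\in N_{diag}(Q)$ (replacing $x\prec y$ by $x\prec u_e\prec y$ in the diagram and taking the reflexive-transitive closure), and no vertex on other edges. $A(Q)$ is the set of pairs $(b,c)\in Diag(Q)\setminus N_{diag}(Q)$ for which there exist $a,d\in Q$ with $a<c$, $b<d$, $(a,b),(c,d)\in Inc(Q)$, and either $(a,c)\in N_{diag}(Q)$ or $(b,d)\in N_{diag}(Q)$. -}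

module Defs where

open import Data.Nat using (ℕ)
open import Data.Fin using (Fin)
open import Data.Fin.Properties using (any?)
open import Data.Product using (Σ; ∃; _×_; _,_; proj₁; proj₂)
open import Data.Product.Properties using () 
open import Relation.Nullary.Decidable using (Dec; ¬?; _×-dec_; True)
open import Data.Sum using (_⊎_; inj₁; inj₂)
open import Relation.Nullary using (¬_)
open import Relation.Binary.PropositionalEquality using (_≡_; _≢_)
open import Relation.Binary.Structures using (IsDecPartialOrder)
open import Relation.Binary.Construct.Closure.ReflexiveTransitive using (Star)

module Notions {A : Set} (_≤_ : A → A → Set) where
  _<_ : A → A → Set
  x < y = (x ≤ y) × (x ≢ y)

  Cover : A → A → Set
  Cover x y = (x < y) × ¬ (∃ λ z → (x < z) × (z < y))

  Inc : A → A → Set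
  Inc x y = ¬ (x ≤ y) × ¬ (y ≤ x)

  IsN : A → A → A → A → Set
  IsN a b c d = Cover b c × Cover a c × Cover b d × Inc a d

  NDiag : A → A → Set
  NDiag b c = ∃ λ a → ∃ λ d → IsN a b c d

  InA : A → A → Set
  InA b c = Cover b c × ¬ NDiag b c ×
    (∃ λ a → ∃ λ d → (a < c) × (b < d) × Inc a b × Inc c d ×
       (NDiag a c ⊎ NDiag b d))

record FinPoset : Set₁ where
  field
    n : ℕ
    _≤_ : Fin n → Fin n → Set
    isDecPartialOrder : IsDecPartialOrder _≡_ _≤_

  open IsDecPartialOrder isDecPartialOrder public using (_≟_; _≤?_)
  open Notions _≤_ public

  <? : ∀ x y → Dec (x < y)
  <? x y = (x ≤? y) ×-dec ¬? (x ≟ y)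

  Cover? : ∀ x y → Dec (Cover x y)
  Cover? x y = <? x y ×-dec ¬? (any? λ z → <? x z ×-dec <? z y)

  Inc? : ∀ x y → Dec (Inc x y)
  Inc? x y = ¬? (x ≤? y) ×-dec ¬? (y ≤? x)

  NDiag? : ∀ b c → Dec (NDiag b c)
  NDiag? b c = any? λ a → any? λ d →
    Cover? b c ×-dec (Cover? a c ×-dec (Cover? b d ×-dec Inc? a d))

  -- the new vertices u_e, one for each e ∈ N_diag(P)
  NEdge : Set
  NEdge = Σ (Fin n × Fin n) λ e → True (NDiag? (proj₁ e) (proj₂ e))

  SNCarrier : Set
  SNCarrier = Fin n ⊎ NEdge

  data SNEdge : SNCarrier → SNCarrier → Set where
    keep : ∀ {x y} → Cover x y → ¬ NDiag x y → SNEdge (inj₁ x) (inj₁ y)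
    up   : ∀ {x y} (t : True (NDiag? x y)) → SNEdge (inj₁ x) (inj₂ ((x , y) , t))
    down : ∀ {x y} (t : True (NDiag? x y)) → SNEdge (inj₂ ((x , y) , t)) (inj₁ y)

  _≤SN_ : SNCarrier → SNCarrier → Set
  _≤SN_ = Star SNEdge

A-SN : (P : FinPoset) → FinPoset.SNCarrier P → FinPoset.SNCarrier P → Set
A-SN P = Notions.InA (FinPoset._≤SN_ P)

-- Write lo s and hi s for the endpoints of the edge of P subdivided by a
-- vertex s of S = S_N(P) (both are s itself for an old vertex). Then s < t in S
-- iff hi s ≤ lo t in P, the covers of S are exactly the edges of its diagram,
-- and a new vertex has exactly one lower and one upper cover.
--
-- Let (b , c) ∈ A(S) with witnesses a , d, and suppose (a , c) is the
-- diagonal of the N  x , a , c , y  of S. The upper cover w of b below d differs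
-- from c, and as (b , c) is no N-diagonal, every lower cover of c lies below w.
-- Uniqueness of the covers of new vertices then leaves only a , b , c , x old.
-- If y is old, (a , c) is an N-diagonal of P, so it would have been subdivided.
-- If y is new, it subdivides an N-diagonal (a , y′) of P, and every upper cover
-- of a other than c is an upper cover of b in S; this turns the N of P on
-- (a , y′) into one on (b , y′), another edge that S left unsubdivided.
-- The case (b , d) ∈ N_diag(S) is the same argument for the opposite poset,
-- because S_N(Pᵒᵖ) is the opposite of S_N(P).
module Submission where

open import Defs
open import Data.Bool.Properties using (T-irrelevant)
open import Data.Empty using (⊥; ⊥-elim)
open import Data.Fin using (Fin)
open import Data.Fin.Induction using (po-wellFounded; po-noetherian)
open import Data.Fin.Properties using (any?)
open import Data.Product using (∃; _×_; _,_; proj₁; proj₂; map₂)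
open import Data.Sum using (inj₁; inj₂)
open import Function using (id; _∘_; flip)
open import Induction.WellFounded using (Acc; acc)
open import Level using (0ℓ)
open import Relation.Binary.Core using (Rel)
open import Relation.Binary.Definitions using (Antisymmetric)
open import Relation.Binary.Structures using (IsPartialOrder; IsDecPartialOrder)
open import Relation.Binary.PropositionalEquality
  using (_≡_; _≢_; refl; sym; trans; cong; subst; subst₂; isEquivalence)
open import Relation.Binary.Construct.Closure.ReflexiveTransitive
  using (Star; ε; _◅_; _◅◅_; gmap; kleisliStar; reverse)
import Relation.Binary.Construct.Flip.EqAndOrd as Flip
import Relation.Binary.Construct.NonStrictToStrict as ToStrict
open import Relation.Nullary using (¬_; yes; no)
open import Relation.Nullary.Decidable
  using (True; toWitness; fromWitness; decidable-stable; _×-dec_)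
open import Relation.Nullary.Negation using (¬¬-map)

module NotionsProperties {A : Set} {_≤_ : Rel A 0ℓ} (po : IsPartialOrder _≡_ _≤_) where
  open IsPartialOrder po using (antisym; ≲-respˡ-≈; ≲-respʳ-≈)
    renaming (refl to ≤-refl; reflexive to ≤-reflexive; trans to ≤-trans)
  open Notions _≤_

  <-≤-trans : ∀ {x y z} → x < y → y ≤ z → x < z
  <-≤-trans = ToStrict.<-≤-trans _≡_ _≤_ sym ≤-trans antisym ≲-respʳ-≈

  ≤-<-trans : ∀ {x y z} → x ≤ y → y < z → x < z
  ≤-<-trans = ToStrict.≤-<-trans _≡_ _≤_ ≤-trans antisym ≲-respˡ-≈

  <⇒≱ : ∀ {x y} → x < y → ¬ y ≤ x
  <⇒≱ = ToStrict.<⇒≱ _≡_ _≤_ antisym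

  Inc⇒≢ : ∀ {x y} → Inc x y → x ≢ y
  Inc⇒≢ (x≰y , _) refl = x≰y ≤-refl

  -- If (b , c) is not the diagonal of an N, a lower cover z of c and an
  -- upper cover w ≠ c of b are comparable, and w ≤ z would put w inside b ≺ c.
  ¬NDiag⇒¬¬< : ∀ {b c z w} → Cover b c → ¬ NDiag b c → Cover z c → Cover b w → w ≢ c →
               ¬ ¬ (z < w)
  ¬NDiag⇒¬¬< b≺c ¬N z≺c b≺w w≢c z≮w = ¬N (_ , _ , b≺c , z≺c , b≺w , z≰w , w≰z)
    where
    w≰z : ¬ _
    w≰z w≤z = proj₂ b≺c (_ , proj₁ b≺w , ≤-<-trans w≤z (proj₁ z≺c))
    z≰w : ¬ _
    z≰w z≤w = z≮w (z≤w , λ z≡w → w≰z (≤-reflexive (sym z≡w)))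

module AntitoneBijection {A B : Set} {_≤₁_ : Rel A 0ℓ} {_≤₂_ : Rel B 0ℓ} (f : A → B) (g : B → A)
  (g∘f : ∀ x → g (f x) ≡ x) (f∘g : ∀ y → f (g y) ≡ y)
  (f-anti : ∀ {x y} → x ≤₁ y → f y ≤₂ f x) (g-anti : ∀ {x y} → x ≤₂ y → g y ≤₁ g x) where
  open Notions _≤₁_
  module N₂ = Notions _≤₂_

  <-anti : ∀ {x y} → x < y → f y N₂.< f x
  <-anti {x} {y} (x≤y , x≢y) =
    f-anti x≤y , λ fy≡fx → x≢y (sym (subst₂ _≡_ (g∘f y) (g∘f x) (cong g fy≡fx)))

  private
    g-<-anti : ∀ {x y} → x N₂.< y → g y < g x
    g-<-anti {x} {y} (x≤y , x≢y) =
      g-anti x≤y , λ gy≡gx → x≢y (sym (subst₂ _≡_ (f∘g y) (f∘g x) (cong f gy≡gx)))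

  Cover-anti : ∀ {x y} → Cover x y → N₂.Cover (f y) (f x)
  Cover-anti {x} {y} (x<y , nothing-between) = <-anti x<y ,
    λ (z , fy<z , z<fx) → nothing-between (g z ,
      subst (_< g z) (g∘f x) (g-<-anti z<fx) , subst (g z <_) (g∘f y) (g-<-anti fy<z))

  Inc-anti : ∀ {x y} → Inc x y → N₂.Inc (f y) (f x)
  Inc-anti {x} {y} (x≰y , y≰x) =
    (λ fy≤fx → x≰y (subst₂ _≤₁_ (g∘f x) (g∘f y) (g-anti fy≤fx))) ,
    (λ fx≤fy → y≰x (subst₂ _≤₁_ (g∘f y) (g∘f x) (g-anti fx≤fy)))

  NDiag-anti : ∀ {b c} → NDiag b c → N₂.NDiag (f c) (f b)
  NDiag-anti (a , d , b≺c , a≺c , b≺d , a∥d) =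
    f d , f a , Cover-anti b≺c , Cover-anti b≺d , Cover-anti a≺c , Inc-anti a∥d

module FinPosetProperties (P : FinPoset) where
  open FinPoset P
  open IsDecPartialOrder isDecPartialOrder using (isPartialOrder)
    renaming (refl to ≤-refl; trans to ≤-trans)

  <⇒∃Cover≤ : ∀ {x y} → Acc _<_ y → x < y → ∃ λ z → Cover x z × z ≤ y
  <⇒∃Cover≤ {x} {y} (acc smaller) x<y with any? (λ z → <? x z ×-dec <? z y)
  ... | yes (z , x<z , z<y) =
    map₂ (map₂ (λ z′≤z → ≤-trans z′≤z (proj₁ z<y))) (<⇒∃Cover≤ (smaller z<y) x<z)
  ... | no nothing-between = y , (x<y , nothing-between) , ≤-refl

  ≤⇒Cover* : ∀ {x y} → x ≤ y → Star Cover x y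
  ≤⇒Cover* {x} = go (po-noetherian isPartialOrder x)
    where
    go : ∀ {x y} → Acc (flip _<_) x → x ≤ y → Star Cover x y
    go {x} {y} (acc larger) x≤y with x ≟ y
    ... | yes refl = ε
    ... | no x≢y with <⇒∃Cover≤ (po-wellFounded isPartialOrder y) (x≤y , x≢y)
    ...   | z , x≺z , z≤y = x≺z ◅ go (larger (proj₁ x≺z)) z≤y

module Subdivision (P : FinPoset) where
  open FinPoset P
  open IsDecPartialOrder isDecPartialOrder using (isPartialOrder)
    renaming (refl to ≤-refl; reflexive to ≤-reflexive; trans to ≤-trans; antisym to ≤-antisym)
  open NotionsProperties isPartialOrder using (<-≤-trans; <⇒≱)
  open FinPosetProperties P
  module S = Notions _≤SN_

  lo hi : SNCarrier → Fin n
  lo (inj₁ x) = x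
  lo (inj₂ ((x , _) , _)) = x
  hi (inj₁ x) = x
  hi (inj₂ ((_ , y) , _)) = y

  lo<hi : ∀ {x y} (t : True (NDiag? x y)) → x < y
  lo<hi t with toWitness t
  ... | _ , _ , x≺y , _ = proj₁ x≺y

  lo≤hi : ∀ s → lo s ≤ hi s
  lo≤hi (inj₁ _) = ≤-refl
  lo≤hi (inj₂ (_ , t)) = proj₁ (lo<hi t)

  SNEdge⇒hi≤lo : ∀ {s t} → SNEdge s t → hi s ≤ lo t
  SNEdge⇒hi≤lo (keep x≺y _) = proj₁ (proj₁ x≺y)
  SNEdge⇒hi≤lo (up _) = ≤-refl
  SNEdge⇒hi≤lo (down _) = ≤-refl

  SNEdge⇒lo<hi : ∀ {s t} → SNEdge s t → lo s < hi t
  SNEdge⇒lo<hi (keep x≺y _) = proj₁ x≺y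
  SNEdge⇒lo<hi (up t) = lo<hi t
  SNEdge⇒lo<hi (down t) = lo<hi t

  ≤SN⇒lo≤lo×hi≤hi : ∀ {s t} → s ≤SN t → lo s ≤ lo t × hi s ≤ hi t
  ≤SN⇒lo≤lo×hi≤hi ε = ≤-refl , ≤-refl
  ≤SN⇒lo≤lo×hi≤hi {s} (_◅_ {j = s₁} e r) =
    ≤-trans (≤-trans (lo≤hi s) (SNEdge⇒hi≤lo e)) (proj₁ (≤SN⇒lo≤lo×hi≤hi r)) ,
    ≤-trans (≤-trans (SNEdge⇒hi≤lo e) (lo≤hi s₁)) (proj₂ (≤SN⇒lo≤lo×hi≤hi r))

  ◅⇒hi≤lo : ∀ {s s₁ t} → SNEdge s s₁ → s₁ ≤SN t → hi s ≤ lo t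
  ◅⇒hi≤lo e r = ≤-trans (SNEdge⇒hi≤lo e) (proj₁ (≤SN⇒lo≤lo×hi≤hi r))

  ◅⇒lo<hi : ∀ {s s₁ t} → SNEdge s s₁ → s₁ ≤SN t → lo s < hi t
  ◅⇒lo<hi e r = <-≤-trans (SNEdge⇒lo<hi e) (proj₂ (≤SN⇒lo≤lo×hi≤hi r))

  SNEdge-acyclic : ∀ {s s₁} → SNEdge s s₁ → ¬ s₁ ≤SN s
  SNEdge-acyclic e r = <⇒≱ (◅⇒lo<hi e r) (◅⇒hi≤lo e r)

  <SN⇒hi≤lo : ∀ {s t} → s S.< t → hi s ≤ lo t
  <SN⇒hi≤lo (ε , s≢s) = ⊥-elim (s≢s refl)
  <SN⇒hi≤lo (e ◅ r , _) = ◅⇒hi≤lo e r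

  ≤SN-antisym : Antisymmetric _≡_ _≤SN_
  ≤SN-antisym ε _ = refl
  ≤SN-antisym (e ◅ r) r′ = ⊥-elim (SNEdge-acyclic e (r ◅◅ r′))

  ≤SN-isPartialOrder : IsPartialOrder _≡_ _≤SN_
  ≤SN-isPartialOrder = record
    { isPreorder = record
      { isEquivalence = isEquivalence
      ; reflexive = λ { refl → ε }
      ; trans = _◅◅_
      }
    ; antisym = ≤SN-antisym
    }

  Cover⇒≤SN : ∀ {x y} → Cover x y → inj₁ x ≤SN inj₁ y
  Cover⇒≤SN {x} {y} x≺y with NDiag? x y
  ... | yes N = up (fromWitness N) ◅ down (fromWitness N) ◅ ε
  ... | no ¬N = keep x≺y ¬N ◅ ε

  ≤⇒≤SN : ∀ {x y} → x ≤ y → inj₁ x ≤SN inj₁ y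
  ≤⇒≤SN = kleisliStar inj₁ Cover⇒≤SN ∘ ≤⇒Cover*

  ≤SN⇒≤ : ∀ {x y} → inj₁ x ≤SN inj₁ y → x ≤ y
  ≤SN⇒≤ = proj₁ ∘ ≤SN⇒lo≤lo×hi≤hi

  pinned : ∀ {k} z → k ≤ lo z → hi z ≤ k → z ≡ inj₁ k
  pinned (inj₁ _) k≤w w≤k = cong inj₁ (≤-antisym w≤k k≤w)
  pinned (inj₂ (_ , t)) k≤lo hi≤k = ⊥-elim (<⇒≱ (lo<hi t) (≤-trans hi≤k k≤lo))

  nothing-inside-SNEdge : ∀ {s t} z → SNEdge s t → hi s ≤ lo z → hi z ≤ lo t → s ≢ z → z ≢ t → ⊥
  nothing-inside-SNEdge z (up _) x≤lo hi≤x s≢z _ = s≢z (sym (pinned z x≤lo hi≤x))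
  nothing-inside-SNEdge z (down _) y≤lo hi≤y _ z≢t = z≢t (pinned z y≤lo hi≤y)
  nothing-inside-SNEdge (inj₁ w) (keep x≺y _) x≤w w≤y s≢z z≢t =
    proj₂ x≺y (w , (x≤w , s≢z ∘ cong inj₁) , (w≤y , z≢t ∘ cong inj₁))
  nothing-inside-SNEdge {inj₁ x} {inj₁ y} (inj₂ ((p , q) , t)) (keep x≺y ¬N) x≤p q≤y _ _
    with x ≟ p | q ≟ y
  ... | no x≢p | _ = proj₂ x≺y (p , (x≤p , x≢p) , <-≤-trans (lo<hi t) q≤y)
  ... | yes refl | no q≢y = proj₂ x≺y (q , lo<hi t , (q≤y , q≢y))
  ... | yes refl | yes refl = ¬N (toWitness t)

  SNEdge⇒CoverSN : ∀ {s t} → SNEdge s t → S.Cover s t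
  SNEdge⇒CoverSN e = (e ◅ ε , λ { refl → SNEdge-acyclic e ε }) ,
    λ (z , s<z , z<t) →
      nothing-inside-SNEdge z e (<SN⇒hi≤lo s<z) (<SN⇒hi≤lo z<t) (proj₂ s<z) (proj₂ z<t)

  CoverSN⇒SNEdge : ∀ {s t} → S.Cover s t → SNEdge s t
  CoverSN⇒SNEdge ((ε , s≢s) , _) = ⊥-elim (s≢s refl)
  CoverSN⇒SNEdge ((e ◅ ε , _) , _) = e
  CoverSN⇒SNEdge ((e ◅ e′ ◅ r , _) , nothing-between) = ⊥-elim (nothing-between
    (_ , (e ◅ ε , λ { refl → SNEdge-acyclic e ε }) , (e′ ◅ r , λ { refl → SNEdge-acyclic e′ r })))

  upper-cover-of-new : ∀ {e s} → S.Cover (inj₂ e) s → s ≡ inj₁ (proj₂ (proj₁ e))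
  upper-cover-of-new u≺s with CoverSN⇒SNEdge u≺s
  ... | down _ = refl

  lower-cover-of-new : ∀ {e s} → S.Cover s (inj₂ e) → s ≡ inj₁ (proj₁ (proj₁ e))
  lower-cover-of-new s≺u with CoverSN⇒SNEdge s≺u
  ... | up _ = refl

  new-upper-cover-unique : ∀ {e s t} → S.Cover (inj₂ e) s → S.Cover (inj₂ e) t → s ≡ t
  new-upper-cover-unique u≺s u≺t = trans (upper-cover-of-new u≺s) (sym (upper-cover-of-new u≺t))

  new-lower-cover-unique : ∀ {e s t} → S.Cover s (inj₂ e) → S.Cover t (inj₂ e) → s ≡ t
  new-lower-cover-unique s≺u t≺u = trans (lower-cover-of-new s≺u) (sym (lower-cover-of-new t≺u))

  CoverSN⇒Cover×¬NDiag : ∀ {x y} → S.Cover (inj₁ x) (inj₁ y) → Cover x y × ¬ NDiag x y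
  CoverSN⇒Cover×¬NDiag x≺y with CoverSN⇒SNEdge x≺y
  ... | keep x≺y ¬N = x≺y , ¬N

  IncSN⇒Inc : ∀ {x y} → S.Inc (inj₁ x) (inj₁ y) → Inc x y
  IncSN⇒Inc (x≰y , y≰x) = x≰y ∘ ≤⇒≤SN , y≰x ∘ ≤⇒≤SN

  <SN⇒CoverSN≤SN : ∀ {s t} → s S.< t → ∃ λ w → S.Cover s w × w ≤SN t
  <SN⇒CoverSN≤SN (ε , s≢s) = ⊥-elim (s≢s refl)
  <SN⇒CoverSN≤SN (e ◅ r , _) = _ , SNEdge⇒CoverSN e , r

  module SP = NotionsProperties ≤SN-isPartialOrder

  ¬NDiagSN⇒hi≤lo : ∀ {b c z w} → S.Cover b c → ¬ S.NDiag b c → S.Cover z c → S.Cover b w → w ≢ c →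
                   hi z ≤ lo w
  ¬NDiagSN⇒hi≤lo {z = z} {w} b≺c ¬N z≺c b≺w w≢c =
    decidable-stable (hi z ≤? lo w) (¬¬-map <SN⇒hi≤lo (SP.¬NDiag⇒¬¬< b≺c ¬N z≺c b≺w w≢c))

  module _ {a b c : Fin n} (b≺c : S.Cover (inj₁ b) (inj₁ c)) (¬N : ¬ S.NDiag (inj₁ b) (inj₁ c))
           (a≺c : S.Cover (inj₁ a) (inj₁ c)) (a∥b : S.Inc (inj₁ a) (inj₁ b)) where
    private
      a≺ₚc : Cover a c × ¬ NDiag a c
      a≺ₚc = CoverSN⇒Cover×¬NDiag a≺c
      b≺ₚc : Cover b c × ¬ NDiag b c
      b≺ₚc = CoverSN⇒Cover×¬NDiag b≺c
      a∥ₚb : Inc a b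
      a∥ₚb = IncSN⇒Inc a∥b

    upper-cover-of-a-above-b : ∀ {t} → Cover a t → b ≤ t
    upper-cover-of-a-above-b {t} a≺t = decidable-stable (b ≤? t) λ b≰t →
      proj₂ a≺ₚc (b , t , proj₁ a≺ₚc , proj₁ b≺ₚc , a≺t , b≰t ,
        λ t≤b → proj₁ a∥ₚb (≤-trans (proj₁ (proj₁ a≺t)) t≤b))

    upper-cover-of-a-covers-b : ∀ {t} → Cover a t → t ≢ c → S.Cover (inj₁ b) (inj₁ t)
    upper-cover-of-a-covers-b {t} a≺t t≢c = via (<SN⇒CoverSN≤SN (≤⇒≤SN b≤t , b≢t))
      where
      a≤t : a ≤ t
      a≤t = proj₁ (proj₁ a≺t)
      b≤t : b ≤ t
      b≤t = upper-cover-of-a-above-b a≺t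
      b≢t : inj₁ b ≢ inj₁ t
      b≢t refl = proj₁ a∥ₚb a≤t
      via : (∃ λ w → S.Cover (inj₁ b) w × w ≤SN inj₁ t) → S.Cover (inj₁ b) (inj₁ t)
      via (w , b≺w , w≤t) = subst (S.Cover (inj₁ b)) (pinned w t≤lo-w hi-w≤t) b≺w
        where
        hi-w≤t : hi w ≤ t
        hi-w≤t = proj₂ (≤SN⇒lo≤lo×hi≤hi w≤t)
        w≢c : w ≢ inj₁ c
        w≢c refl = proj₂ a≺t (c , proj₁ (proj₁ a≺ₚc) , ≤SN⇒≤ w≤t , t≢c ∘ sym)
        a≤lo-w : a ≤ lo w
        a≤lo-w = ¬NDiagSN⇒hi≤lo b≺c ¬N a≺c b≺w w≢c
        b≤lo-w : b ≤ lo w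
        b≤lo-w = proj₁ (≤SN⇒lo≤lo×hi≤hi (proj₁ (proj₁ b≺w)))
        t≤lo-w : t ≤ lo w
        t≤lo-w = decidable-stable (t ≤? lo w) λ t≰lo → proj₂ a≺t (lo w ,
          (a≤lo-w , λ a≡lo → proj₂ a∥ₚb (subst (b ≤_) (sym a≡lo) b≤lo-w)) ,
          ≤-trans (lo≤hi w) hi-w≤t , λ lo≡t → t≰lo (≤-reflexive (sym lo≡t)))

    -- Every upper cover of a other than c also covers b, so an N of P with
    -- diagonal (a , y) yields one with diagonal (b , y), an unsubdivided edge.
    ¬NDiag-from-a : ∀ {y} → ¬ NDiag a y
    ¬NDiag-from-a {y} (p , q , a≺y , p≺y , a≺q , p∥q) with y ≟ c
    ... | yes refl = proj₂ a≺ₚc (p , q , a≺y , p≺y , a≺q , p∥q)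
    ... | no y≢c = proj₂ b≺ₚy (p , q , proj₁ b≺ₚy , p≺y , b≺q , p∥q)
      where
      b≺ₚy : Cover b y × ¬ NDiag b y
      b≺ₚy = CoverSN⇒Cover×¬NDiag (upper-cover-of-a-covers-b a≺y y≢c)
      b≺q : Cover b q
      b≺q with q ≟ c
      ... | yes q≡c = subst (Cover b) (sym q≡c) (proj₁ b≺ₚc)
      ... | no q≢c = proj₁ (CoverSN⇒Cover×¬NDiag (upper-cover-of-a-covers-b a≺q q≢c))

  -- A new vertex has a single lower and a single upper cover; this rules out
  -- every configuration but the one where a , b , c and x are old.
  upper-cover≢⇒¬NDiag-ac : ∀ {a b c w} → S.Cover b c → ¬ S.NDiag b c → S.Inc a b →
                           S.Cover b w → w ≢ c → ¬ S.NDiag a c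
  upper-cover≢⇒¬NDiag-ac {b = inj₂ _} b≺c _ _ b≺w w≢c _ = w≢c (new-upper-cover-unique b≺w b≺c)
  upper-cover≢⇒¬NDiag-ac {c = inj₂ _} b≺c _ a∥b _ _ (_ , _ , a≺c , _) =
    SP.Inc⇒≢ a∥b (new-lower-cover-unique a≺c b≺c)
  upper-cover≢⇒¬NDiag-ac {a = inj₂ _} _ _ _ _ _ (x , _ , a≺c , x≺c , a≺y , x∥y) =
    proj₁ x∥y (subst (x ≤SN_) (new-upper-cover-unique a≺c a≺y) (proj₁ (proj₁ x≺c)))
  upper-cover≢⇒¬NDiag-ac b≺c ¬N _ b≺w w≢c (inj₂ _ , _ , _ , x≺c , _) =
    SP.¬NDiag⇒¬¬< b≺c ¬N x≺c b≺w w≢c λ x<w →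
      let (v , x≺v , v≤w) = <SN⇒CoverSN≤SN x<w
      in proj₂ b≺w (_ , proj₁ b≺c ,
           subst (_≤SN _) (new-upper-cover-unique x≺v x≺c) v≤w , w≢c ∘ sym)
  upper-cover≢⇒¬NDiag-ac {inj₁ _} {inj₁ _} {inj₁ _} _ _ _ _ _
    (inj₁ _ , inj₁ _ , a≺c , x≺c , a≺y , x∥y) =
    proj₂ (CoverSN⇒Cover×¬NDiag a≺c) (_ , _ , proj₁ (CoverSN⇒Cover×¬NDiag a≺c) ,
      proj₁ (CoverSN⇒Cover×¬NDiag x≺c) , proj₁ (CoverSN⇒Cover×¬NDiag a≺y) , IncSN⇒Inc x∥y)
  upper-cover≢⇒¬NDiag-ac {inj₁ _} {inj₁ _} {inj₁ _} b≺c ¬N a∥b _ _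
    (inj₁ _ , inj₂ _ , a≺c , _ , a≺y , _) with CoverSN⇒SNEdge a≺y
  ... | up t = ¬NDiag-from-a b≺c ¬N a≺c a∥b (toWitness t)

  ¬NDiag-ac : ∀ {a b c d} → S.Cover b c → ¬ S.NDiag b c → S.Inc a b → S.Inc c d → b S.< d →
              ¬ S.NDiag a c
  ¬NDiag-ac b≺c ¬N a∥b c∥d b<d with <SN⇒CoverSN≤SN b<d
  ... | w , b≺w , w≤d = upper-cover≢⇒¬NDiag-ac b≺c ¬N a∥b b≺w λ { refl → proj₁ c∥d w≤d }

opposite : FinPoset → FinPoset
opposite P = record
  { n = n
  ; _≤_ = flip _≤_
  ; isDecPartialOrder = record
    { isPartialOrder = Flip.isPartialOrder isPartialOrder
    ; _≟_ = _≟_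
    ; _≤?_ = flip _≤?_
    }
  }
  where
  open FinPoset P using (n; _≤_; isDecPartialOrder)
  open IsDecPartialOrder isDecPartialOrder using (isPartialOrder; _≟_; _≤?_)

module Duality (P : FinPoset) where
  private
    module P = FinPoset P
    module Q = FinPoset (opposite P)
    module P⇄Q = AntitoneBijection {_≤₁_ = P._≤_} {_≤₂_ = Q._≤_}
      id id (λ _ → refl) (λ _ → refl) id id
    module Q⇄P = AntitoneBijection {_≤₁_ = Q._≤_} {_≤₂_ = P._≤_}
      id id (λ _ → refl) (λ _ → refl) id id
    module S = Notions P._≤SN_

  dual : P.SNCarrier → Q.SNCarrier
  dual (inj₁ x) = inj₁ x
  dual (inj₂ ((x , y) , t)) = inj₂ ((y , x) , fromWitness (P⇄Q.NDiag-anti (toWitness t)))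

  undual : Q.SNCarrier → P.SNCarrier
  undual (inj₁ x) = inj₁ x
  undual (inj₂ ((y , x) , t)) = inj₂ ((x , y) , fromWitness (Q⇄P.NDiag-anti (toWitness t)))

  undual∘dual : ∀ s → undual (dual s) ≡ s
  undual∘dual (inj₁ _) = refl
  undual∘dual (inj₂ (e , _)) = cong (λ t → inj₂ (e , t)) (T-irrelevant _ _)

  dual∘undual : ∀ s → dual (undual s) ≡ s
  dual∘undual (inj₁ _) = refl
  dual∘undual (inj₂ (e , _)) = cong (λ t → inj₂ (e , t)) (T-irrelevant _ _)

  dual-SNEdge : ∀ {s t} → P.SNEdge s t → Q.SNEdge (dual t) (dual s)
  dual-SNEdge (P.keep x≺y ¬N) = Q.keep (P⇄Q.Cover-anti x≺y) (¬N ∘ Q⇄P.NDiag-anti)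
  dual-SNEdge (P.up _) = Q.down _
  dual-SNEdge (P.down _) = Q.up _

  undual-SNEdge : ∀ {s t} → Q.SNEdge s t → P.SNEdge (undual t) (undual s)
  undual-SNEdge (Q.keep x≺y ¬N) = P.keep (Q⇄P.Cover-anti x≺y) (¬N ∘ P⇄Q.NDiag-anti)
  undual-SNEdge (Q.up _) = P.down _
  undual-SNEdge (Q.down _) = P.up _

  dual-anti : ∀ {s t} → s P.≤SN t → dual t Q.≤SN dual s
  dual-anti = gmap dual id ∘ reverse dual-SNEdge

  undual-anti : ∀ {s t} → s Q.≤SN t → undual t P.≤SN undual s
  undual-anti = gmap undual id ∘ reverse undual-SNEdge

  module Dual = AntitoneBijection {_≤₁_ = P._≤SN_} {_≤₂_ = Q._≤SN_}
    dual undual undual∘dual dual∘undual dual-anti undual-anti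
  module Undual = AntitoneBijection {_≤₁_ = Q._≤SN_} {_≤₂_ = P._≤SN_}
    undual dual dual∘undual undual∘dual undual-anti dual-anti

  ¬NDiag-bd : ∀ {a b c d} → S.Cover b c → ¬ S.NDiag b c → a S.< c → S.Inc a b → S.Inc c d →
              ¬ S.NDiag b d
  ¬NDiag-bd {b = b} {c} b≺c ¬N a<c a∥b c∥d =
    Subdivision.¬NDiag-ac (opposite P) (Dual.Cover-anti b≺c) ¬N′
      (Dual.Inc-anti c∥d) (Dual.Inc-anti a∥b) (Dual.<-anti a<c) ∘ Dual.NDiag-anti
    where
    ¬N′ : ¬ Dual.N₂.NDiag (dual c) (dual b)
    ¬N′ N′ = ¬N (subst₂ S.NDiag (undual∘dual b) (undual∘dual c) (Undual.NDiag-anti N′))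

lemma4 : (P : FinPoset) → ∀ b c → ¬ A-SN P b c
lemma4 P _ _ (b≺c , ¬N , _ , _ , a<c , b<d , a∥b , c∥d , inj₁ N-ac) =
  Subdivision.¬NDiag-ac P b≺c ¬N a∥b c∥d b<d N-ac
lemma4 P _ _ (b≺c , ¬N , _ , _ , a<c , b<d , a∥b , c∥d , inj₂ N-bd) =
  Duality.¬NDiag-bd P b≺c ¬N a<c a∥b c∥d N-bd
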